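{- For integers $k \geq 2$ and $n \geq 6$, $$ gr_{k}(K_{3} : W_{n}) \geq \begin{cases} (3n - 4) 5^{\frac{k - 2}{2}} + 1 & \text{ if $n$ is even and $k$ is even;}\\ (6n - 8) 5^{\frac{k - 3}{2}} + 1 & \text{ if $n$ is even and $k$ is odd;}\\ (2n - 3) 5^{\frac{k - 2}{2}} + 1 & \text{ if $n$ is odd and $k$ is even;}\\ (4n - 6) 5^{\frac{k - 3}{2}} + 1 & \text{ if $n$ is odd and $k$ is odd.} \end{cases} $$
   Context: For $n \geq 4$, the wheel $W_n$ is the graph of order $n$ given by $W_n = K_1 \vee C_{n-1}$, i.e., a cycle on $n-1$ vertices together with one additional vertex adjacent to all vertices of the cycle. For graphs $G$, $H$ and a positive integer $k$, the Gallai-Ramsey number $gr_k(G:H)$ is the minimum integer $m$ such that every coloring of the edges of $K_m$ using at most $k$ colors contains either a rainbow copy of $G$ (all edges receiving distinct colors) or a monochromatic copy of $H$. -}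

module Defs where

open import Data.Nat using (ℕ; zero; suc; _+_; _*_; _∸_; _^_; _≤_)
open import Data.Nat.DivMod using (_/_; _%_)
open import Data.Fin using (Fin; toℕ)
open import Data.Product using (Σ; _×_; ∃-syntax)
open import Data.Sum using (_⊎_)
open import Relation.Binary.PropositionalEquality using (_≡_; _≢_)
open import Function.Definitions using (Injective)

-- An edge colouring of the complete graph K_m using at most k colours:
-- a symmetric function on pairs of vertices (the value on the diagonal
-- is irrelevant, since K_m has no loops).
Colouring : ℕ → ℕ → Set
Colouring m k = Fin m → Fin m → Fin k

Symmetric : ∀ {m k} → Colouring m k → Set
Symmetric {m} c = ∀ (i j : Fin m) → c i j ≡ c j i

RainbowK3 : ∀ {m k} → Colouring m k → Set
RainbowK3 {m} c =
  Σ (Fin m) λ a → Σ (Fin m) λ b → Σ (Fin m) λ d →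
    (a ≢ b) × (b ≢ d) × (a ≢ d) ×
    (c a b ≢ c b d) × (c b d ≢ c a d) × (c a b ≢ c a d)

-- Adjacency in the cycle C_ℓ on vertex set Fin ℓ = {0,…,ℓ-1}:
-- i ~ i+1 and (ℓ-1) ~ 0 (directed listing; colouring is symmetric).
CycleStep : (ℓ : ℕ) → Fin ℓ → Fin ℓ → Set
CycleStep ℓ i j = (toℕ j ≡ suc (toℕ i)) ⊎ ((toℕ i ≡ ℓ ∸ 1) × (toℕ j ≡ 0))

-- A monochromatic copy of the wheel W_n = K_1 ∨ C_{n-1} (not necessarily
-- induced): a hub vertex and an injective embedding of the cycle C_{n-1}
-- avoiding the hub, such that all spokes and all rim edges have colour α.
MonoWheel : ∀ {m k} → ℕ → Colouring m k → Set
MonoWheel {m} {k} n c =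
  Σ (Fin m) λ hub → Σ (Fin (n ∸ 1) → Fin m) λ g →
    Injective _≡_ _≡_ g × (∀ i → g i ≢ hub) ×
    Σ (Fin k) λ α →
      (∀ i → c hub (g i) ≡ α) ×
      (∀ i j → CycleStep (n ∸ 1) i j → c (g i) (g j) ≡ α)

-- "m has the Gallai–Ramsey property for (K_3 : W_n) with k colours":
-- every colouring of K_m with at most k colours contains a rainbow K_3
-- or a monochromatic W_n.  gr_k(K_3 : W_n) is the least such m, so
-- "gr_k(K_3 : W_n) ≥ L" means every such m satisfies L ≤ m.
GRProperty : ℕ → ℕ → ℕ → Set
GRProperty k n m =
  ∀ (c : Colouring m k) → Symmetric c → RainbowK3 c ⊎ MonoWheel n c

lowerBound : ℕ → ℕ → ℕ
lowerBound k n with n % 2 | k % 2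
... | 0 | 0 = (3 * n ∸ 4) * 5 ^ ((k ∸ 2) / 2) + 1
... | 0 | _ = (6 * n ∸ 8) * 5 ^ ((k ∸ 3) / 2) + 1
... | _ | 0 = (2 * n ∸ 3) * 5 ^ ((k ∸ 2) / 2) + 1
... | _ | _ = (4 * n ∸ 6) * 5 ^ ((k ∸ 3) / 2) + 1

{-# OPTIONS --safe #-}
module Submission where

-- All four bounds come from explicit colourings of K_m with no rainbow triangle
-- and no monochromatic W_n.  A monochromatic K_{n-1} is one.  Substituting such a
-- colouring C for the vertices of a pattern Π, whose edges get fresh colours,
-- preserves both properties provided Π itself has no rainbow triangle and no
-- monochromatic homomorphic image of W_n: a wheel in an old colour lies in one
-- copy of C, a wheel in a new colour projects onto Π.  Three patterns qualify:
-- K_2, K_3 when the rim n - 1 is odd (an odd cycle is not 2-colourable), and the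
-- 2-coloured K_5 whose colour classes are pentagons (triangle-free).  Starting
-- from K_3 (n even) or K_2 (n odd), an extra K_2 for odd k, and then pentagons for
-- the remaining colours give orders 3(n-1)·5^j, 6(n-1)·5^j, 2(n-1)·5^j and
-- 4(n-1)·5^j, at least the stated bounds minus one.

open import Defs
open import Data.Nat using (ℕ; zero; suc; _+_; _*_; _∸_; _^_; _≤_; _<_; _≤?_; _<?_; _≟_; z≤n; s≤s)
open import Data.Nat.Properties
open import Data.Nat.DivMod using (_/_; _%_; m≡m%n+[m/n]*n; m/n*n≤m)
open import Data.Fin as Fin using (Fin; toℕ; fromℕ<; inject≤; punchOut)
open import Data.Fin.Properties using (*↔×; toℕ-fromℕ<; fromℕ<-cong; inject≤-injective; punchOut-injective; injective⇒≤; all?)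
open import Data.Vec.Functional using (_∷_)
open import Data.Product using (∃-syntax; _×_; _,_; proj₁; proj₂)
open import Data.Sum using (_⊎_; inj₁; inj₂; [_,_]′) renaming (map to ⊎-map)
open import Data.Empty using (⊥)
open import Data.Bool using (if_then_else_)
open import Relation.Nullary using (¬_; yes; no; does; contradiction)
open import Relation.Nullary.Decidable using (dec-true; dec-false; from-yes; toSum; ¬?; _→-dec_; _⊎-dec_)
open import Relation.Binary.PropositionalEquality
open import Function using (_∘_)
open import Function.Bundles using (Injection)
open import Function.Definitions using (Injective)
open import Function.Properties.Inverse using (↔⇒↣)

NotRainbow : ℕ → ℕ → ℕ → Set
NotRainbow x y z = (x ≡ y) ⊎ (y ≡ z) ⊎ (x ≡ z)

NotRainbow-resp : ∀ {x y z x′ y′ z′} → x ≡ x′ → y ≡ y′ → z ≡ z′ →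
                  NotRainbow x′ y′ z′ → NotRainbow x y z
NotRainbow-resp refl refl refl r = r

NotRainbow-+ : ∀ {x y z} K → NotRainbow x y z → NotRainbow (x + K) (y + K) (z + K)
NotRainbow-+ K = ⊎-map (cong (_+ K)) (⊎-map (cong (_+ K)) (cong (_+ K)))

record IsGallai {X : Set} (c : X → X → ℕ) : Set where
  field
    symmetric  : ∀ a b → c a b ≡ c b a
    notRainbow : ∀ a b d → a ≢ b → b ≢ d → a ≢ d → NotRainbow (c a b) (c b d) (c a d)

monochromatic-isGallai : ∀ {X : Set} → IsGallai {X} (λ _ _ → 0)
monochromatic-isGallai = record
  { symmetric  = λ _ _ → refl
  ; notRainbow = λ _ _ _ _ _ _ → inj₁ refl
  }

IsGallai-∘ : ∀ {X Y : Set} {c : X → X → ℕ} (f : Y → X) → Injective _≡_ _≡_ f →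
             IsGallai c → IsGallai (λ a b → c (f a) (f b))
IsGallai-∘ f f-injective G = record
  { symmetric  = λ a b → symmetric (f a) (f b)
  ; notRainbow = λ a b d a≢b b≢d a≢d →
      notRainbow (f a) (f b) (f d) (a≢b ∘ f-injective) (b≢d ∘ f-injective) (a≢d ∘ f-injective)
  }
  where open IsGallai G

MonoWheelFree : ℕ → {X : Set} → (X → X → ℕ) → Set
MonoWheelFree ℓ {X} c =
  ∀ (hub : X) (g : Fin ℓ → X) → Injective _≡_ _≡_ g → (∀ i → g i ≢ hub) →
  ∀ α → (∀ i → c hub (g i) ≡ α) → (∀ i j → CycleStep ℓ i j → c (g i) (g j) ≡ α) → ⊥

MonoWheelFree-∘ : ∀ {ℓ} {X Y : Set} {c : X → X → ℕ} (f : Y → X) → Injective _≡_ _≡_ f →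
                  MonoWheelFree ℓ c → MonoWheelFree ℓ (λ a b → c (f a) (f b))
MonoWheelFree-∘ f f-injective free hub g g-injective g≢hub =
  free (f hub) (f ∘ g) (g-injective ∘ f-injective) (λ i → g≢hub i ∘ f-injective)

MonoWheelHomFree : ℕ → {X : Set} → (X → X → ℕ) → Set
MonoWheelHomFree ℓ {X} c =
  ∀ (hub : X) (g : Fin ℓ → X) → (∀ i → g i ≢ hub) →
  ∀ α → (∀ i → c hub (g i) ≡ α) →
  (∀ i j → CycleStep ℓ i j → g i ≢ g j × c (g i) (g j) ≡ α) → ⊥

MonoTriangleFree : {X : Set} → (X → X → ℕ) → Set
MonoTriangleFree {X} c =
  ∀ (a b d : X) → a ≢ b → b ≢ d → a ≢ d → c a b ≡ c b d → c b d ≡ c a d → ⊥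

monoTriangleFree⇒monoWheelHomFree : ∀ {ℓ} {X : Set} {c : X → X → ℕ} →
                                    MonoTriangleFree c → MonoWheelHomFree (2 + ℓ) c
monoTriangleFree⇒monoWheelHomFree free hub g g≢hub α spoke rim =
  free hub (g 0F) (g 1F) (g≢hub 0F ∘ sym) (proj₁ firstEdge) (g≢hub 1F ∘ sym)
       (trans (spoke 0F) (sym (proj₂ firstEdge))) (trans (proj₂ firstEdge) (sym (spoke 1F)))
  where
  0F = Fin.zero
  1F = Fin.suc Fin.zero
  firstEdge = rim 0F 1F (inj₁ refl)

record WheelFreeColouring (ℓ S K : ℕ) : Set where
  field
    colour        : Fin S → Fin S → ℕ
    isGallai      : IsGallai colour
    monoWheelFree : MonoWheelFree ℓ colour
    colour<K      : ∀ a b → colour a b < K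

record BlowUpPattern (ℓ p P : ℕ) : Set where
  field
    colour           : Fin p → Fin p → ℕ
    isGallai         : IsGallai colour
    monoWheelHomFree : MonoWheelHomFree ℓ colour
    colour<P         : ∀ i j → colour i j < P

WheelFreeColouring-weaken : ∀ {ℓ S K K′} → K ≤ K′ → WheelFreeColouring ℓ S K → WheelFreeColouring ℓ S K′
WheelFreeColouring-weaken K≤K′ C = record
  { colour        = colour
  ; isGallai      = isGallai
  ; monoWheelFree = monoWheelFree
  ; colour<K      = λ a b → <-≤-trans (colour<K a b) K≤K′
  }
  where open WheelFreeColouring C

WheelFreeColouring-restrict : ∀ {ℓ S K m} → m ≤ S → WheelFreeColouring ℓ S K → WheelFreeColouring ℓ m K
WheelFreeColouring-restrict {m = m} m≤S C = record
  { colour        = λ a b → colour (ι a) (ι b)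
  ; isGallai      = IsGallai-∘ ι ι-injective isGallai
  ; monoWheelFree = MonoWheelFree-∘ {c = colour} ι ι-injective monoWheelFree
  ; colour<K      = λ a b → colour<K (ι a) (ι b)
  }
  where
  open WheelFreeColouring C
  ι : Fin m → Fin _
  ι a = inject≤ a m≤S
  ι-injective : Injective _≡_ _≡_ ι
  ι-injective = inject≤-injective m≤S m≤S _ _

∷-injective : ∀ {n} {X : Set} {x : X} {g : Fin n → X} →
              Injective _≡_ _≡_ g → (∀ i → g i ≢ x) → Injective _≡_ _≡_ (x ∷ g)
∷-injective _           _   {Fin.zero}  {Fin.zero}  _ = refl
∷-injective _           g≢x {Fin.zero}  {Fin.suc j} e = contradiction (sym e) (g≢x j)
∷-injective _           g≢x {Fin.suc i} {Fin.zero}  e = contradiction e (g≢x i)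
∷-injective g-injective _   {Fin.suc i} {Fin.suc j} e = cong Fin.suc (g-injective e)

-- A wheel with rim length ℓ has ℓ + 1 vertices, too many for K_ℓ.
monochromatic : ∀ ℓ → WheelFreeColouring ℓ ℓ 1
monochromatic ℓ = record
  { colour        = λ _ _ → 0
  ; isGallai      = monochromatic-isGallai
  ; monoWheelFree = λ hub g g-injective g≢hub _ _ _ →
      1+n≰n (injective⇒≤ (∷-injective g-injective g≢hub))
  ; colour<K      = λ _ _ → s≤s z≤n
  }

module BlowUp {ℓ p P M K} (Π : BlowUpPattern ℓ p P) (C : WheelFreeColouring ℓ M K) where
  private
    module Π  = BlowUpPattern Π
    module C  = WheelFreeColouring C
    module ΠG = IsGallai Π.isGallai
    module CG = IsGallai C.isGallai

  Vertex : Set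
  Vertex = Fin p × Fin M

  colour : Vertex → Vertex → ℕ
  colour (i , y) (i′ , y′) = if does (i Fin.≟ i′) then C.colour y y′ else Π.colour i i′ + K

  colour-inside : ∀ {i i′} y y′ → i ≡ i′ → colour (i , y) (i′ , y′) ≡ C.colour y y′
  colour-inside {i} {i′} _ _ i≡i′ rewrite dec-true (i Fin.≟ i′) i≡i′ = refl

  colour-across : ∀ {i i′} y y′ → i ≢ i′ → colour (i , y) (i′ , y′) ≡ Π.colour i i′ + K
  colour-across {i} {i′} _ _ i≢i′ rewrite dec-false (i Fin.≟ i′) i≢i′ = refl

  colour<P+K : ∀ a b → colour a b < P + K
  colour<P+K (i , y) (i′ , y′) with toSum (i Fin.≟ i′)
  ... | inj₁ i≡i′ = subst (_< P + K) (sym (colour-inside y y′ i≡i′)) (<-≤-trans (C.colour<K y y′) (m≤n+m K P))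
  ... | inj₂ i≢i′ = subst (_< P + K) (sym (colour-across y y′ i≢i′)) (+-monoˡ-< K (Π.colour<P i i′))

  sameBlock : ∀ a b {α} → colour a b ≡ α → α < K → proj₁ a ≡ proj₁ b
  sameBlock (i , y) (i′ , y′) ab≡α α<K with toSum (i Fin.≟ i′)
  ... | inj₁ i≡i′ = i≡i′
  ... | inj₂ i≢i′ = contradiction (subst (K ≤_) (trans (sym (colour-across y y′ i≢i′)) ab≡α) (m≤n+m K _))
                                  (<⇒≱ α<K)

  acrossBlocks : ∀ a b {α} → colour a b ≡ α → K ≤ α →
                 proj₁ a ≢ proj₁ b × Π.colour (proj₁ a) (proj₁ b) ≡ α ∸ K
  acrossBlocks (i , y) (i′ , y′) ab≡α K≤α with toSum (i Fin.≟ i′)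
  ... | inj₁ i≡i′ = contradiction K≤α
                      (<⇒≱ (subst (_< K) (trans (sym (colour-inside y y′ i≡i′)) ab≡α) (C.colour<K y y′)))
  ... | inj₂ i≢i′ = i≢i′ , trans (sym (m+n∸n≡m _ K)) (cong (_∸ K) (trans (sym (colour-across y y′ i≢i′)) ab≡α))

  symmetric : ∀ a b → colour a b ≡ colour b a
  symmetric (i , y) (i′ , y′) with toSum (i Fin.≟ i′)
  ... | inj₁ i≡i′ = begin
    colour (i , y) (i′ , y′)   ≡⟨ colour-inside y y′ i≡i′ ⟩
    C.colour y y′              ≡⟨ CG.symmetric y y′ ⟩
    C.colour y′ y              ≡⟨ colour-inside y′ y (sym i≡i′) ⟨
    colour (i′ , y′) (i , y)   ∎
    where open ≡-Reasoning
  ... | inj₂ i≢i′ = begin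
    colour (i , y) (i′ , y′)   ≡⟨ colour-across y y′ i≢i′ ⟩
    Π.colour i i′ + K          ≡⟨ cong (_+ K) (ΠG.symmetric i i′) ⟩
    Π.colour i′ i + K          ≡⟨ colour-across y′ y (i≢i′ ∘ sym) ⟨
    colour (i′ , y′) (i , y)   ∎
    where open ≡-Reasoning

  notRainbow : ∀ a b d → a ≢ b → b ≢ d → a ≢ d → NotRainbow (colour a b) (colour b d) (colour a d)
  notRainbow (i , y) (i′ , y′) (i″ , y″) a≢b b≢d a≢d
    with toSum (i Fin.≟ i′) | toSum (i′ Fin.≟ i″) | toSum (i Fin.≟ i″)
  ... | inj₁ refl | inj₁ refl | _ =
    NotRainbow-resp (colour-inside y y′ refl) (colour-inside y′ y″ refl) (colour-inside y y″ refl)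
      (CG.notRainbow y y′ y″ (a≢b ∘ cong (i ,_)) (b≢d ∘ cong (i ,_)) (a≢d ∘ cong (i ,_)))
  ... | inj₁ refl | inj₂ i≢i″ | _ =
    inj₂ (inj₁ (trans (colour-across y′ y″ i≢i″) (sym (colour-across y y″ i≢i″))))
  ... | inj₂ i≢i′ | inj₁ refl | _ =
    inj₂ (inj₂ (trans (colour-across y y′ i≢i′) (sym (colour-across y y″ i≢i′))))
  ... | inj₂ i≢i′ | inj₂ i′≢i | inj₁ refl =
    inj₁ (trans (colour-across y y′ i≢i′)
           (trans (cong (_+ K) (ΠG.symmetric i i′)) (sym (colour-across y′ y″ i′≢i))))
  ... | inj₂ i≢i′ | inj₂ i′≢i″ | inj₂ i≢i″ =
    NotRainbow-resp (colour-across y y′ i≢i′) (colour-across y′ y″ i′≢i″) (colour-across y y″ i≢i″)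
      (NotRainbow-+ K (ΠG.notRainbow i i′ i″ i≢i′ i′≢i″ i≢i″))

  isGallai : IsGallai colour
  isGallai = record { symmetric = symmetric ; notRainbow = notRainbow }

  monoWheelFree : MonoWheelFree ℓ colour
  monoWheelFree (h , yh) g g-injective g≢hub α spoke rim with K ≤? α
  ... | yes K≤α =
    Π.monoWheelHomFree h (proj₁ ∘ g) (λ i → proj₁ (crossing i) ∘ sym) (α ∸ K)
      (λ i → proj₂ (crossing i)) (λ i j s → acrossBlocks (g i) (g j) (rim i j s) K≤α)
    where
    crossing = λ i → acrossBlocks (h , yh) (g i) (spoke i) K≤α
  ... | no K≰α =
    C.monoWheelFree yh (proj₂ ∘ g)
      (λ {i} {j} e → g-injective (cong₂ _,_ (trans (inHubBlock i) (sym (inHubBlock j))) e))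
      (λ i e → g≢hub i (cong₂ _,_ (inHubBlock i) e)) α
      (λ i → trans (sym (colour-inside yh (proj₂ (g i)) (sym (inHubBlock i)))) (spoke i))
      (λ i j s → trans (sym (colour-inside (proj₂ (g i)) (proj₂ (g j))
                                          (trans (inHubBlock i) (sym (inHubBlock j))))) (rim i j s))
    where
    inHubBlock : ∀ i → proj₁ (g i) ≡ h
    inHubBlock i = sym (sameBlock (h , yh) (g i) (spoke i) (≰⇒> K≰α))

blowUp : ∀ {ℓ p P M K} → BlowUpPattern ℓ p P → WheelFreeColouring ℓ M K →
         WheelFreeColouring ℓ (p * M) (P + K)
blowUp {p = p} {M = M} Π C = record
  { colour        = λ a b → colour (to a) (to b)
  ; isGallai      = IsGallai-∘ to injective isGallai
  ; monoWheelFree = MonoWheelFree-∘ {c = colour} to injective monoWheelFree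
  ; colour<K      = λ a b → colour<P+K (to a) (to b)
  }
  where
  open BlowUp Π C
  open Injection (↔⇒↣ (*↔× {p} {M})) using (to; injective)

Fin2-x≢y⇒y≢z⇒x≡z : ∀ {x y z : Fin 2} → x ≢ y → y ≢ z → x ≡ z
Fin2-x≢y⇒y≢z⇒x≡z {Fin.zero}          {_}                 {Fin.zero}          _   _   = refl
Fin2-x≢y⇒y≢z⇒x≡z {Fin.suc Fin.zero}  {_}                 {Fin.suc Fin.zero}  _   _   = refl
Fin2-x≢y⇒y≢z⇒x≡z {Fin.zero}          {Fin.zero}          {Fin.suc Fin.zero}  x≢y _   = contradiction refl x≢y
Fin2-x≢y⇒y≢z⇒x≡z {Fin.zero}          {Fin.suc Fin.zero}  {Fin.suc Fin.zero}  _   y≢z = contradiction refl y≢z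
Fin2-x≢y⇒y≢z⇒x≡z {Fin.suc Fin.zero}  {Fin.zero}          {Fin.zero}          _   y≢z = contradiction refl y≢z
Fin2-x≢y⇒y≢z⇒x≡z {Fin.suc Fin.zero}  {Fin.suc Fin.zero}  {Fin.zero}          x≢y _   = contradiction refl x≢y

Odd : ℕ → Set
Odd ℓ = ∃[ q ] ℓ ≡ suc (q * 2)

oddCycle-not-2-colourable : ∀ {ℓ} → Odd ℓ → (f : Fin ℓ → Fin 2) →
                            ¬ (∀ i j → CycleStep ℓ i j → f i ≢ f j)
oddCycle-not-2-colourable (q , refl) f proper =
  proper (fromℕ< last) Fin.zero (inj₂ (toℕ-fromℕ< last , refl)) (evenVertex q last)
  where
  last = n<1+n (q * 2)

  consecutive : ∀ {t} (p : t < suc (q * 2)) (p′ : suc t < suc (q * 2)) →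
                CycleStep (suc (q * 2)) (fromℕ< p) (fromℕ< p′)
  consecutive p p′ = inj₁ (trans (toℕ-fromℕ< p′) (cong suc (sym (toℕ-fromℕ< p))))

  evenVertex : ∀ t (p : t * 2 < suc (q * 2)) → f (fromℕ< p) ≡ f Fin.zero
  evenVertex zero    _ = refl
  evenVertex (suc t) p = trans (sym (Fin2-x≢y⇒y≢z⇒x≡z (proper _ _ (consecutive p₀ p₁))
                                                   (proper _ _ (consecutive p₁ p))))
                               (evenVertex t p₀)
    where
    p₁ = <-trans (n<1+n (suc (t * 2))) p
    p₀ = <-trans (n<1+n (t * 2)) p₁

pair : ∀ {ℓ} → BlowUpPattern (2 + ℓ) 2 1
pair = record
  { colour           = λ _ _ → 0
  ; isGallai         = monochromatic-isGallai
  ; monoWheelHomFree = monoTriangleFree⇒monoWheelHomFree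
      (λ _ _ _ a≢b b≢d a≢d _ _ → a≢d (Fin2-x≢y⇒y≢z⇒x≡z a≢b b≢d))
  ; colour<P         = λ _ _ → s≤s z≤n
  }

-- The rim avoids the hub, so it is a proper 2-colouring of an odd cycle by the
-- two remaining vertices.
triangle : ∀ {ℓ} → Odd ℓ → BlowUpPattern ℓ 3 1
triangle odd = record
  { colour           = λ _ _ → 0
  ; isGallai         = monochromatic-isGallai
  ; monoWheelHomFree = λ hub g g≢hub _ _ rim →
      oddCycle-not-2-colourable odd (λ i → punchOut (g≢hub i ∘ sym))
        (λ i j s → proj₁ (rim i j s) ∘ punchOut-injective (g≢hub i ∘ sym) (g≢hub j ∘ sym))
  ; colour<P         = λ _ _ → s≤s z≤n
  }

-- Colour 0 on the pentagon 0-1-2-3-4-0, colour 1 on the complementary pentagram.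
pentagonColour : Fin 5 → Fin 5 → ℕ
pentagonColour i j with suc (toℕ i) % 5 ≟ toℕ j | suc (toℕ j) % 5 ≟ toℕ i
... | no _ | no _ = 1
... | _    | _    = 0

pentagon : ∀ {ℓ} → BlowUpPattern (2 + ℓ) 5 2
pentagon = record
  { colour           = pentagonColour
  ; isGallai         = record
    { symmetric  = from-yes (all? λ i → all? λ j → c i j ≟ c j i)
    ; notRainbow = from-yes (all? λ i → all? λ j → all? λ l →
        ¬? (i Fin.≟ j) →-dec ¬? (j Fin.≟ l) →-dec ¬? (i Fin.≟ l) →-dec
        ((c i j ≟ c j l) ⊎-dec (c j l ≟ c i l) ⊎-dec (c i j ≟ c i l)))
    }
  ; monoWheelHomFree = monoTriangleFree⇒monoWheelHomFree (from-yes (all? λ i → all? λ j → all? λ l →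
        ¬? (i Fin.≟ j) →-dec ¬? (j Fin.≟ l) →-dec ¬? (i Fin.≟ l) →-dec
        ((c i j ≟ c j l) →-dec ¬? (c j l ≟ c i l))))
  ; colour<P         = from-yes (all? λ i → all? λ j → c i j <? 2)
  }
  where c = pentagonColour

iterate-pentagon : ∀ {ℓ S K} j → WheelFreeColouring (2 + ℓ) S K →
                   WheelFreeColouring (2 + ℓ) (5 ^ j * S) (j * 2 + K)
iterate-pentagon {S = S} zero C =
  subst (λ s → WheelFreeColouring _ s _) (sym (+-identityʳ S)) C
iterate-pentagon {ℓ} {S} {K} (suc j) C =
  subst (λ s → WheelFreeColouring (2 + ℓ) s (suc j * 2 + K)) (sym (*-assoc 5 (5 ^ j) S))
        (blowUp pentagon (iterate-pentagon j C))

¬GRProperty : ∀ {k n m} → WheelFreeColouring (n ∸ 1) m k → ¬ GRProperty k n m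
¬GRProperty {k} {n} {m} C gr = [ noRainbow , noWheel ]′ (gr c c-symmetric)
  where
  open WheelFreeColouring C
  open IsGallai isGallai

  c : Colouring m k
  c a b = fromℕ< (colour<K a b)

  raise : ∀ {a b a′ b′} → colour a b ≡ colour a′ b′ → c a b ≡ c a′ b′
  raise e = fromℕ<-cong _ _ e _ _

  lower : ∀ {a b α} → c a b ≡ α → colour a b ≡ toℕ α
  lower e = trans (sym (toℕ-fromℕ< _)) (cong toℕ e)

  c-symmetric : Symmetric c
  c-symmetric a b = raise (symmetric a b)

  noRainbow : ¬ RainbowK3 c
  noRainbow (a , b , d , a≢b , b≢d , a≢d , r₁ , r₂ , r₃) =
    [ r₁ ∘ raise , [ r₂ ∘ raise , r₃ ∘ raise ]′ ]′ (notRainbow a b d a≢b b≢d a≢d)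

  noWheel : ¬ MonoWheel n c
  noWheel (hub , g , g-injective , g≢hub , α , spoke , rim) =
    monoWheelFree hub g g-injective g≢hub (toℕ α) (lower ∘ spoke) (λ i j s → lower (rim i j s))

wheelFreeColouring⇒< : ∀ {k n m S} → WheelFreeColouring (n ∸ 1) S k → GRProperty k n m → S < m
wheelFreeColouring⇒< {n = n} {m} {S} C gr with m ≤? S
... | yes m≤S = contradiction gr (¬GRProperty {n = n} (WheelFreeColouring-restrict m≤S C))
... | no m≰S  = ≰⇒> m≰S

pentagon-lowerBound : ∀ {ℓ k m S K} A → A ≤ S → K ≤ k → WheelFreeColouring (2 + ℓ) S K →
                      GRProperty k (3 + ℓ) m → A * 5 ^ ((k ∸ K) / 2) + 1 ≤ m
pentagon-lowerBound {ℓ} {k} {m} {S} {K} A A≤S K≤k C gr = begin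
  A * 5 ^ j + 1    ≡⟨ +-comm _ 1 ⟩
  suc (A * 5 ^ j)  ≤⟨ s≤s (*-monoˡ-≤ (5 ^ j) A≤S) ⟩
  suc (S * 5 ^ j)  ≡⟨ cong suc (*-comm S (5 ^ j)) ⟩
  suc (5 ^ j * S)  ≤⟨ wheelFreeColouring⇒< {n = 3 + ℓ} (WheelFreeColouring-weaken budget (iterate-pentagon j C)) gr ⟩
  m                ∎
  where
  open ≤-Reasoning
  j = (k ∸ K) / 2
  budget : j * 2 + K ≤ k
  budget = ≤-trans (+-monoˡ-≤ K (m/n*n≤m (k ∸ K) 2)) (≤-reflexive (m∸n+n≡m K≤k))

m*n∸o≤m*[n∸1] : ∀ m n {o} → m ≤ o → m * n ∸ o ≤ m * (n ∸ 1)
m*n∸o≤m*[n∸1] m n {o} m≤o = begin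
  m * n ∸ o      ≤⟨ ∸-monoʳ-≤ (m * n) m≤o ⟩
  m * n ∸ m      ≡⟨ cong (m * n ∸_) (*-identityʳ m) ⟨
  m * n ∸ m * 1  ≡⟨ *-distribˡ-∸ m n 1 ⟨
  m * (n ∸ 1)    ∎
  where open ≤-Reasoning

even⇒pred-odd : ∀ n → suc n % 2 ≡ 0 → Odd n
even⇒pred-odd n even with suc n / 2 | trans (m≡m%n+[m/n]*n (suc n) 2) (cong (_+ suc n / 2 * 2) even)
... | suc q | e = q , suc-injective e

odd⇒3≤ : ∀ {k r} → 2 ≤ k → k % 2 ≡ suc r → 3 ≤ k
odd⇒3≤ {suc zero}          (s≤s ()) _
odd⇒3≤ {suc (suc zero)}    _ ()
odd⇒3≤ {suc (suc (suc _))} _ _ = s≤s (s≤s (s≤s z≤n))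

theorem8 : ∀ (k n : ℕ) → 2 ≤ k → 6 ≤ n →
    ∀ (m : ℕ) → GRProperty k n m → lowerBound k n ≤ m
theorem8 k n@(suc (suc (suc ℓ))) 2≤k (s≤s (s≤s (s≤s _))) m gr with n % 2 in n%2 | k % 2 in k%2
... | 0     | 0     = pentagon-lowerBound (3 * n ∸ 4) (m*n∸o≤m*[n∸1] 3 n (m≤m+n 3 1)) 2≤k
                        (blowUp (triangle odd) (monochromatic _)) gr
  where odd = even⇒pred-odd _ n%2
... | 0     | suc _ = pentagon-lowerBound (6 * n ∸ 8)
                        (≤-trans (m*n∸o≤m*[n∸1] 6 n (m≤m+n 6 2)) (≤-reflexive (*-assoc 2 3 (n ∸ 1))))
                        (odd⇒3≤ 2≤k k%2) (blowUp pair (blowUp (triangle odd) (monochromatic _))) gr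
  where odd = even⇒pred-odd _ n%2
... | suc _ | 0     = pentagon-lowerBound (2 * n ∸ 3) (m*n∸o≤m*[n∸1] 2 n (m≤m+n 2 1)) 2≤k
                        (blowUp pair (monochromatic _)) gr
... | suc _ | suc _ = pentagon-lowerBound (4 * n ∸ 6)
                        (≤-trans (m*n∸o≤m*[n∸1] 4 n (m≤m+n 4 2)) (≤-reflexive (*-assoc 2 2 (n ∸ 1))))
                        (odd⇒3≤ 2≤k k%2) (blowUp pair (blowUp pair (monochromatic _))) gr
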